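{- Let $E$ be a finite set, $\mathbb{G}$ an $\mathsf{E}$-group, $\alpha\subseteq E$ and $n\geq1$. Suppose $\mathbb{G}[\alpha]$ is compatible with every free amalgamation chain $\bigoplus_{i=1}^m(\mathrm{Cayley}(\mathbb{G})[\alpha_i],g_i)$ of length $m\leq n$ whose constituents satisfy $\alpha_i\subsetneq\alpha$. Then $\mathbb{G}[\alpha]$ is $N$-acyclic for $N=n+2$.
   Context: An $\mathsf{E}$-group is a group $\mathbb{G}=(G,\cdot,1)$ containing $E$ as pairwise distinct non-trivial involutions generating it; $[w]_{\mathbb{G}}=e_1\cdots e_n$ for $w=e_1\cdots e_n\in E^*$; $\mathbb{G}[\gamma]$ is the subgroup generated by $\gamma\subseteq E$; $\mathrm{Cayley}(\mathbb{G})[\gamma]$ is the graph on $\mathbb{G}[\gamma]$ with edge relations $R_e=\{(g,ge)\}$ for $e\in\gamma$. Free amalgamation chain: given $\alpha_1,\dots,\alpha_m\subsetneq E$, $\alpha_{i,i+1}:=\alpha_i\cap\alpha_{i+1}$, and $g_i\in\mathbb{G}[\alpha_i]$ such that for each $i$ the cosets $\mathbb{G}[\alpha_{i-1,i}]$ and $g_i\mathbb{G}[\alpha_{i,i+1}]$ (whenever both are defined) are disjoint, the chain $\bigoplus_{i=1}^m(\mathrm{Cayley}(\mathbb{G})[\alpha_i],g_i)$ is obtained from disjoint copies $A_i$ of $\mathrm{Cayley}(\mathbb{G})[\alpha_i]$ by identifying, for each $i<m$ and each $x\in\mathbb{G}[\alpha_{i,i+1}]$, the element $g_ix$ of $A_i$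 with the element $x$ of $A_{i+1}$; each edge relation $R_e$ is the union of the images of those of the constituents. This is an edge-coloured graph $(V,(R_e)_{e\in E})$ in which each $R_e$ is symmetric with at most one neighbour per vertex; $\pi_e$ swaps ends of $R_e$-edges and fixes the other vertices, $[w]_{\mathbb{H}}=\pi_{e_k}\circ\cdots\circ\pi_{e_1}$. $\mathbb{G}[\alpha]$ is compatible with such $\mathbb{H}$ if $[w]_{\mathbb{G}}=1$ implies $[w]_{\mathbb{H}}=\mathrm{id}_V$ for all $w\in\alpha^*$. A coset cycle of length $k\ge2$ in $\mathbb{G}[\alpha]$ is $(h_i\mathbb{G}[\beta_i],h_i)_{i\in\mathbb{Z}_k}$ with $h_i\in\mathbb{G}[\alpha]$, $\beta_i\subseteq\alpha$, $h_{i+1}\in h_i\mathbb{G}[\beta_i]$ and $h_i\mathbb{G}[\beta_i\cap\beta_{i-1}]\cap h_{i+1}\mathbb{G}[\beta_i\cap\beta_{i+1}]=\emptyset$ for all $i$; $N$-acyclic means no coset cycle of length $k$ with $2\le k\le N$. -}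

module Defs where

open import Level using (Level; _⊔_) renaming (suc to lsuc)
open import Data.Nat using (ℕ; zero; suc; _+_; _≤_; _<_; _∸_)
open import Data.Nat.DivMod using (_%_; m%n<n)
open import Data.Fin using (Fin; toℕ; fromℕ<)
open import Data.Fin.Subset using (Subset; _∈_; _⊆_; _⊂_; _∩_; ⊤)
open import Data.List using (List; []; _∷_)
open import Data.List.Relation.Unary.All using (All)
open import Data.Product using (Σ; ∃; _×_; _,_)
open import Data.Sum using (_⊎_)
open import Relation.Nullary using (¬_)
open import Relation.Binary.PropositionalEquality using (_≡_)
open import Relation.Binary.Construct.Closure.Equivalence using (EqClosure)
open import Algebra.Bundles using (Group)

csuc : ∀ {k} → Fin k → Fin k
csuc {suc k} i = fromℕ< (m%n<n (suc (toℕ i)) (suc k))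

cpred : ∀ {k} → Fin k → Fin k
cpred {suc k} i = fromℕ< (m%n<n (toℕ i + k) (suc k))

-- E-groups, with E = Fin k (an arbitrary finite set)

evalW : ∀ {k c ℓ} (G : Group c ℓ) → (Fin k → Group.Carrier G) → List (Fin k) → Group.Carrier G
evalW G ι []      = Group.ε G
evalW G ι (e ∷ w) = Group._∙_ G (ι e) (evalW G ι w)

record EGroup (k : ℕ) (c ℓ : Level) : Set (lsuc (c ⊔ ℓ)) where
  field
    group : Group c ℓ
  open Group group
  field
    ι         : Fin k → Carrier
    ι-inj     : ∀ e e′ → ι e ≈ ι e′ → e ≡ e′
    ι-nontriv : ∀ e → ¬ (ι e ≈ ε)
    ι-invol   : ∀ e → ι e ∙ ι e ≈ ε
    generated : ∀ g → ∃ λ w → evalW group ι w ≈ g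

module EG {k : ℕ} {c ℓ : Level} (𝔾 : EGroup k c ℓ) where
  open EGroup 𝔾 public
  open Group group public

  eval : List (Fin k) → Carrier
  eval = evalW group ι

  Word∈ : Subset k → List (Fin k) → Set
  Word∈ γ w = All (_∈ γ) w

  _∈G[_] : Carrier → Subset k → Set ℓ
  g ∈G[ γ ] = ∃ λ w → Word∈ γ w × eval w ≈ g

  _∈_G[_] : Carrier → Carrier → Subset k → Set (c ⊔ ℓ)
  x ∈ h G[ γ ] = ∃ λ y → y ∈G[ γ ] × x ≈ h ∙ y

  record CosetCycle (α : Subset k) (n : ℕ) : Set (c ⊔ ℓ) where
    field
      h    : Fin n → Carrier
      β    : Fin n → Subset k
      h∈   : ∀ i → h i ∈G[ α ]
      β⊆   : ∀ i → β i ⊆ α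
      step : ∀ i → h (csuc i) ∈ h i G[ β i ]
      disj : ∀ i → ¬ (∃ λ x → x ∈ h i G[ β i ∩ β (cpred i) ]
                             × x ∈ h (csuc i) G[ β i ∩ β (csuc i) ])

  Acyclic : ℕ → Subset k → Set (c ⊔ ℓ)
  Acyclic N α = ∀ n → 2 ≤ n → n ≤ N → ¬ CosetCycle α n

  -- Free amalgamation chains of length m (constituents indexed 0 … m-1)

  record Chain (m : ℕ) : Set (c ⊔ ℓ) where
    field
      αs   : ℕ → Subset k
      gs   : ℕ → Carrier
      αs⊂E : ∀ i → i < m → αs i ⊂ ⊤
      gs∈  : ∀ i → i < m → gs i ∈G[ αs i ]
      disj : ∀ i → suc (suc i) < m →
             ¬ (∃ λ x → x ∈G[ αs i ∩ αs (suc i) ]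
                      × x ∈ gs (suc i) G[ αs (suc i) ∩ αs (suc (suc i)) ])

  module _ {m : ℕ} (C : Chain m) where
    open Chain C

    -- elements of the disjoint union of the copies A_i
    Pre : Set (c ⊔ ℓ)
    Pre = Σ ℕ λ i → i < m × Σ Carrier λ g → g ∈G[ αs i ]

    -- generating identifications: equality inside a copy, and
    -- g_i x ∈ A_i  ~  x ∈ A_{i+1} for x ∈ G[α_{i,i+1}]
    data Glue : Pre → Pre → Set (c ⊔ ℓ) where
      inside : ∀ {i p g q p′ g′ q′} → g ≈ g′ → Glue (i , p , g , q) (i , p′ , g′ , q′)
      glue   : ∀ {i p g q p′ x q′} → x ∈G[ αs i ∩ αs (suc i) ] → g ≈ gs i ∙ x →
               Glue (i , p , g , q) (suc i , p′ , x , q′)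

    -- vertices of the chain = equivalence classes of Same
    Same : Pre → Pre → Set (c ⊔ ℓ)
    Same = EqClosure Glue

    Edge : Fin k → Pre → Pre → Set ℓ
    Edge e (i , _ , g , _) (j , _ , g′ , _) = i ≡ j × e ∈ αs i × g′ ≈ g ∙ ι e

    -- R_e: union of the images of the edge relations of the constituents
    R : Fin k → Pre → Pre → Set (c ⊔ ℓ)
    R e v v′ = ∃ λ u → ∃ λ u′ → Same v u × Edge e u u′ × Same u′ v′

    -- graph of π_e
    π : Fin k → Pre → Pre → Set (c ⊔ ℓ)
    π e v v′ = R e v v′ ⊎ (Same v v′ × ¬ (∃ λ u → R e v u))

    -- graph of [w]_H = π_{e_k} ∘ ⋯ ∘ π_{e_1}
    Act : List (Fin k) → Pre → Pre → Set (c ⊔ ℓ)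
    Act []      v v′ = Same v v′
    Act (e ∷ w) v v′ = ∃ λ u → π e v u × Act w u v′

    Compatible : Subset k → Set (c ⊔ ℓ)
    Compatible α = ∀ w → Word∈ α w → eval w ≈ ε → ∀ v v′ → Act w v v′ → Same v v′

{-# OPTIONS --safe #-}
module Submission where

-- Given a coset cycle (h_j G[β_j])_{j ∈ ℤ_N} with N ≤ n + 2, write h_{j+1} = h_j [w_j] with w_j a
-- word over β_j. Disjointness of consecutive cosets forces β_j ⊊ α, and the pairs (β_j, [w_j]) for
-- 1 ≤ j ≤ m, where m = max(N − 2, 1), form a free amalgamation chain of length m ≤ n. The word
-- w_0 w_1 ⋯ w_{N−1} evaluates to h_0⁻¹ h_N = 1 in G, yet in the chain it moves some vertex: read
-- backwards, w_0 stays in the coset G[β_1 ∩ β_0] of the first copy; w_1, …, w_m carry 1 of the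
-- first copy to [w_m] in the last one, crossing each gluing; and the rest w_{m+1} ⋯ w_{N−1} (empty if
-- N = 2) stays in the coset [w_m] G[β_m ∩ β_{m+1}] of the last copy. Both regions are unions of
-- identification classes, and the disjointness condition of the cycle keeps them apart.

open import Defs
open import Level using (Level; _⊔_)
open import Data.Nat using (ℕ; zero; suc; _+_; _≤_; _<_; _%_; z≤n; s≤s; s≤s⁻¹)
open import Data.Nat.Properties using (+-suc; +-comm; +-identityʳ; ≤-refl; ≤-trans; m≤n+m; <-irrefl)
open import Data.Nat.DivMod using (m%n<n; %-distribˡ-+; m%n%n≡m%n; [m+n]%n≡m%n; n%n≡0)
open import Data.Fin using (Fin; toℕ; fromℕ<)
open import Data.Fin.Properties using (toℕ-fromℕ<; fromℕ<-cong)
open import Data.Fin.Subset using (Subset; _∈_; _∩_; _⊆_; _⊂_)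
open import Data.Fin.Subset.Properties using (_∈?_; _⊂?_; x∈p∩q⁺; x∈p∩q⁻; ⊆⊤; ⊂-⊆-trans)
open import Data.List using (List; []; _∷_; _++_)
import Data.List.Relation.Unary.All as All
open import Data.List.Relation.Unary.All using ([]; _∷_)
open import Data.List.Relation.Unary.All.Properties using (++⁺)
open import Data.Product using (∃; _×_; _,_; proj₁; proj₂)
open import Data.Sum using (_⊎_; inj₁; inj₂)
open import Data.Empty using (⊥; ⊥-elim)
open import Function.Bundles using (_⇔_; mk⇔; Equivalence)
open import Function.Properties.Equivalence using (⇔-isEquivalence)
open import Relation.Nullary using (¬_; yes; no)
open import Relation.Binary.PropositionalEquality as ≡ using (_≡_)
import Relation.Binary.Construct.Closure.Equivalence as EqClosure

[m+n%d]%d≡[m+n]%d : ∀ m n d → (m + n % suc d) % suc d ≡ (m + n) % suc d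
[m+n%d]%d≡[m+n]%d m n d = begin
  (m + n % D) % D           ≡⟨ %-distribˡ-+ m (n % D) D ⟩
  (m % D + n % D % D) % D   ≡⟨ ≡.cong (λ x → (m % D + x) % D) (m%n%n≡m%n n D) ⟩
  (m % D + n % D) % D       ≡⟨ %-distribˡ-+ m n D ⟨
  (m + n) % D               ∎
  where open ≡.≡-Reasoning
        D = suc d

[m%d+n]%d≡[m+n]%d : ∀ m n d → (m % suc d + n) % suc d ≡ (m + n) % suc d
[m%d+n]%d≡[m+n]%d m n d = begin
  (m % D + n) % D   ≡⟨ ≡.cong (_% D) (+-comm (m % D) n) ⟩
  (n + m % D) % D   ≡⟨ [m+n%d]%d≡[m+n]%d n m d ⟩
  (n + m) % D       ≡⟨ ≡.cong (_% D) (+-comm n m) ⟩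
  (m + n) % D       ∎
  where open ≡.≡-Reasoning
        D = suc d

p∩q⊆q∩p : ∀ {n} (p q : Subset n) → p ∩ q ⊆ q ∩ p
p∩q⊆q∩p p q x∈p∩q = let (x∈p , x∈q) = x∈p∩q⁻ p q x∈p∩q in x∈p∩q⁺ (x∈q , x∈p)

module CyclicIndex (n : ℕ) where

  index : ℕ → Fin (suc n)
  index j = fromℕ< (m%n<n j (suc n))

  toℕ-index : ∀ j → toℕ (index j) ≡ j % suc n
  toℕ-index j = toℕ-fromℕ< (m%n<n j (suc n))

  csuc-index : ∀ j → csuc (index j) ≡ index (suc j)
  csuc-index j = fromℕ<-cong _ _ (begin
    suc (toℕ (index j)) % suc n   ≡⟨ ≡.cong (λ x → suc x % suc n) (toℕ-index j) ⟩
    (1 + j % suc n) % suc n       ≡⟨ [m+n%d]%d≡[m+n]%d 1 j n ⟩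
    suc j % suc n                 ∎) _ _
    where open ≡.≡-Reasoning

  cpred-index : ∀ j → cpred (index (suc j)) ≡ index j
  cpred-index j = fromℕ<-cong _ _ (begin
    (toℕ (index (suc j)) + n) % suc n   ≡⟨ ≡.cong (λ x → (x + n) % suc n) (toℕ-index (suc j)) ⟩
    (suc j % suc n + n) % suc n         ≡⟨ [m%d+n]%d≡[m+n]%d (suc j) n n ⟩
    (suc j + n) % suc n                 ≡⟨ ≡.cong (_% suc n) (+-suc j n) ⟨
    (j + suc n) % suc n                 ≡⟨ [m+n]%n≡m%n j (suc n) ⟩
    j % suc n                           ∎) _ _
    where open ≡.≡-Reasoning

  index-period : index (suc n) ≡ index 0
  index-period = fromℕ<-cong _ _ (n%n≡0 (suc n)) (m%n<n (suc n) (suc n)) (m%n<n 0 (suc n))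

module Subgroups {c ℓ : Level} {k : ℕ} (𝔾 : EGroup k c ℓ) where
  open EG 𝔾

  eval-++ : ∀ u v → eval (u ++ v) ≈ eval u ∙ eval v
  eval-++ []      v = sym (identityˡ _)
  eval-++ (e ∷ u) v = trans (∙-congˡ (eval-++ u v)) (sym (assoc _ _ _))

  ε∈G : ∀ {γ} → ε ∈G[ γ ]
  ε∈G = [] , [] , refl

  ∙ι∈G : ∀ {γ g e} → g ∈G[ γ ] → e ∈ γ → (g ∙ ι e) ∈G[ γ ]
  ∙ι∈G {e = e} (u , u∈γ , u≈g) e∈γ =
    u ++ e ∷ [] , ++⁺ u∈γ (e∈γ ∷ []) , trans (eval-++ u (e ∷ [])) (∙-cong u≈g (identityʳ _))

  ∈G-mono : ∀ {γ δ g} → γ ⊆ δ → g ∈G[ γ ] → g ∈G[ δ ]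
  ∈G-mono γ⊆δ (u , u∈γ , u≈g) = u , All.map γ⊆δ u∈γ , u≈g

  ∈coset-self : ∀ {h γ} → h ∈ h G[ γ ]
  ∈coset-self = ε , ε∈G , sym (identityʳ _)

  ∈coset-resp : ∀ {x y h γ} → x ≈ y → x ∈ h G[ γ ] → y ∈ h G[ γ ]
  ∈coset-resp x≈y (z , z∈G , x≈hz) = z , z∈G , trans (sym x≈y) x≈hz

  ∈coset-∙ι : ∀ {x h γ e} → x ∈ h G[ γ ] → e ∈ γ → (x ∙ ι e) ∈ h G[ γ ]
  ∈coset-∙ι (z , z∈G , x≈hz) e∈γ = z ∙ ι _ , ∙ι∈G z∈G e∈γ , trans (∙-congʳ x≈hz) (assoc _ _ _)

module ChainGraph {c ℓ : Level} {k : ℕ} (𝔾 : EGroup k c ℓ) {m : ℕ} (C : EG.Chain 𝔾 m) where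
  open EG 𝔾
  open Chain C
  open Subgroups 𝔾

  Same-refl : ∀ {a} → Same C a a
  Same-refl = EqClosure.reflexive (Glue C)

  Same-sym : ∀ {a b} → Same C a b → Same C b a
  Same-sym = EqClosure.symmetric (Glue C)

  Same-trans : ∀ {a b d} → Same C a b → Same C b d → Same C a d
  Same-trans = EqClosure.transitive (Glue C)

  Same-invariant : (P : Pre C → Set (c ⊔ ℓ)) → (∀ {a b} → Glue C a b → P a ⇔ P b) →
                   ∀ {a b} → Same C a b → P a → P b
  Same-invariant P Glue-invariant a~b =
    Equivalence.to (EqClosure.gfold ⇔-isEquivalence P Glue-invariant a~b)

  Edge-sym : ∀ {e u u′} → Edge C e u u′ → Edge C e u′ u
  Edge-sym {e} {_ , _ , g , _} {_ , _ , g′ , _} (≡.refl , e∈ , g′≈gι) = ≡.refl , e∈ , sym g′ι≈g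
    where
      g′ι≈g : g′ ∙ ι e ≈ g
      g′ι≈g = begin
        g′ ∙ ι e           ≈⟨ ∙-congʳ g′≈gι ⟩
        g ∙ ι e ∙ ι e      ≈⟨ assoc _ _ _ ⟩
        g ∙ (ι e ∙ ι e)    ≈⟨ ∙-congˡ (ι-invol e) ⟩
        g ∙ ε              ≈⟨ identityʳ g ⟩
        g                  ∎
        where open import Relation.Binary.Reasoning.Setoid setoid

  R-sym : ∀ {e a b} → R C e a b → R C e b a
  R-sym {e} (u , u′ , a~u , edge , u′~b) =
    u′ , u , Same-sym u′~b , Edge-sym {e} {u} {u′} edge , Same-sym a~u

  R-respˡ : ∀ {e a a′ b} → Same C a′ a → R C e a b → R C e a′ b
  R-respˡ a′~a (u , u′ , a~u , edge , u′~b) = u , u′ , Same-trans a′~a a~u , edge , u′~b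

  π-respˡ : ∀ {e a a′ b} → Same C a′ a → π C e a b → π C e a′ b
  π-respˡ a′~a (inj₁ r)            = inj₁ (R-respˡ a′~a r)
  π-respˡ a′~a (inj₂ (a~b , no-r)) =
    inj₂ (Same-trans a′~a a~b , λ (u , r) → no-r (u , R-respˡ (Same-sym a′~a) r))

  Act-respˡ : ∀ w {a a′ b} → Same C a′ a → Act C w a b → Act C w a′ b
  Act-respˡ []      a′~a a~b              = Same-trans a′~a a~b
  Act-respˡ (e ∷ w) a′~a (u , a→u , u→b) = u , π-respˡ a′~a a→u , u→b

  Act-++ : ∀ u {v a b d} → Act C u a b → Act C v b d → Act C (u ++ v) a d
  Act-++ []          {v} a~b b→d         = Act-respˡ v a~b b→d
  Act-++ (e ∷ u) (x , a→x , x→b) b→d = x , a→x , Act-++ u x→b b→d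

  Act-within-copy : ∀ {j} (p : j < m) {w} → Word∈ (αs j) w →
    ∀ {rest d x y} (x∈ : x ∈G[ αs j ]) (y∈ : y ∈G[ αs j ]) → y ≈ x ∙ eval w →
    Act C rest (j , p , y , y∈) d → Act C (w ++ rest) (j , p , x , x∈) d
  Act-within-copy p [] {rest} x∈ y∈ y≈xε y→d =
    Act-respˡ rest (EqClosure.return (Glue.inside (sym (trans y≈xε (identityʳ _))))) y→d
  Act-within-copy {j} p (e∈ ∷ w∈) x∈ y∈ y≈xew y→d =
    (j , p , _ , ∙ι∈G x∈ e∈) ,
    inj₁ (_ , _ , Same-refl , (≡.refl , e∈ , refl) , Same-refl) ,
    Act-within-copy p w∈ (∙ι∈G x∈ e∈) y∈ (trans y≈xew (sym (assoc _ _ _))) y→d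

  Stable : (Pre C → Set (c ⊔ ℓ)) → Fin k → Set (c ⊔ ℓ)
  Stable P e = ∀ {x} → P x → (∃ λ y → R C e x y × P y) ⊎ ¬ (∃ λ y → R C e x y)

  module _ {P : Pre C → Set (c ⊔ ℓ)} {γ : Subset k} (stable : ∀ {e} → e ∈ γ → Stable P e) where

    π-stays : ∀ {e x} → e ∈ γ → P x → ∃ λ y → P y × π C e x y
    π-stays e∈ px with stable e∈ px
    ... | inj₁ (y , r , py) = y , py , inj₁ r
    ... | inj₂ no-r         = _ , px , inj₂ (Same-refl , no-r)

    π-stays⁻ : ∀ {e x} → e ∈ γ → P x → ∃ λ y → P y × π C e y x
    π-stays⁻ e∈ px with stable e∈ px
    ... | inj₁ (y , r , py) = y , py , inj₁ (R-sym r)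
    ... | inj₂ no-r         = _ , px , inj₂ (Same-refl , no-r)

    Act-stays : ∀ {w x} → Word∈ γ w → P x → ∃ λ y → P y × Act C w x y
    Act-stays []          px = _ , px , Same-refl
    Act-stays (e∈ ∷ w∈) px =
      let (y , py , x→y) = π-stays e∈ px
          (z , pz , y→z) = Act-stays w∈ py
      in z , pz , (y , x→y , y→z)

    Act-stays⁻ : ∀ {w x} → Word∈ γ w → P x → ∃ λ y → P y × Act C w y x
    Act-stays⁻ []          px = _ , px , Same-refl
    Act-stays⁻ (e∈ ∷ w∈) px =
      let (y , py , y→x) = Act-stays⁻ w∈ px
          (z , pz , z→y) = π-stays⁻ e∈ py
      in z , pz , (y , z→y , y→x)

  InCoset : ℕ → Carrier → Subset k → Pre C → Set (c ⊔ ℓ)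
  InCoset I h δ (i , _ , g , _) = i ≡ I × g ∈ h G[ δ ]

  InCoset-stable : ∀ {I h γ e} →
                   (∀ {a b} → Same C a b → InCoset I h (αs I ∩ γ) a → InCoset I h (αs I ∩ γ) b) →
                   e ∈ γ → Stable (InCoset I h (αs I ∩ γ)) e
  InCoset-stable {I} {e = e} closed e∈γ {_ , p , g , g∈} (≡.refl , g∈hG) with e ∈? αs I
  ... | yes e∈αs = inj₁ ((I , p , g ∙ ι e , ∙ι∈G g∈ e∈αs) ,
                         (_ , _ , Same-refl , (≡.refl , e∈αs , refl) , Same-refl) ,
                         ≡.refl , ∈coset-∙ι g∈hG (x∈p∩q⁺ (e∈αs , e∈γ)))
  ... | no e∉αs  = inj₂ λ (_ , u , _ , x~u , (_ , e∈αs , _) , _) →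
                     e∉αs (≡.subst (λ j → e ∈ αs j) (proj₁ (closed x~u (≡.refl , g∈hG))) e∈αs)

module CycleChains {c ℓ : Level} {k : ℕ} (𝔾 : EGroup k c ℓ) {α : Subset k} {K : ℕ}
                   (cycle : EG.CosetCycle 𝔾 α (suc (suc K))) where
  open EG 𝔾
  open CosetCycle cycle
  open Subgroups 𝔾
  open CyclicIndex (suc K)
  open import Algebra.Properties.Group group using (identityʳ-unique)

  H : ℕ → Carrier
  H j = h (index j)

  B : ℕ → Subset k
  B j = β (index j)

  H-periodic : H (suc (suc K)) ≈ H 0
  H-periodic = reflexive (≡.cong h index-period)

  H-step-coset : ∀ j → H (suc j) ∈ H j G[ B j ]
  H-step-coset j = ≡.subst (λ i → h i ∈ H j G[ B j ]) (csuc-index j) (step (index j))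

  w : ℕ → List (Fin k)
  w j = proj₁ (proj₁ (proj₂ (H-step-coset j)))

  w∈B : ∀ j → Word∈ (B j) (w j)
  w∈B j = proj₁ (proj₂ (proj₁ (proj₂ (H-step-coset j))))

  g : ℕ → Carrier
  g j = eval (w j)

  g∈G : ∀ j → g j ∈G[ B j ]
  g∈G j = w j , w∈B j , refl

  H-step : ∀ j → H j ∙ g j ≈ H (suc j)
  H-step j =
    let (_ , (_ , _ , g≈y) , H′≈Hy) = H-step-coset j in sym (trans H′≈Hy (∙-congˡ (sym g≈y)))

  cosets-disjoint : ∀ j {x} → x ∈ H (suc j) G[ B (suc j) ∩ B j ] →
                    ¬ x ∈ H (suc (suc j)) G[ B (suc j) ∩ B (suc (suc j)) ]
  cosets-disjoint j {x} x∈ x∈′ = disj (index (suc j))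
    ( x
    , ≡.subst (λ i → x ∈ H (suc j) G[ B (suc j) ∩ β i ]) (≡.sym (cpred-index j)) x∈
    , ≡.subst (λ i → x ∈ h i G[ B (suc j) ∩ β i ]) (≡.sym (csuc-index (suc j))) x∈′ )

  translated-cosets-disjoint : ∀ j {a b} → a ∈G[ B (suc j) ∩ B j ] →
                               b ∈G[ B (suc j) ∩ B (suc (suc j)) ] → ¬ a ≈ g (suc j) ∙ b
  translated-cosets-disjoint j {a} {b} a∈ b∈ a≈gb =
    cosets-disjoint j (a , a∈ , refl) (b , b∈ , Ha≈H′b)
    where
      Ha≈H′b : H (suc j) ∙ a ≈ H (suc (suc j)) ∙ b
      Ha≈H′b = begin
        H (suc j) ∙ a                  ≈⟨ ∙-congˡ a≈gb ⟩
        H (suc j) ∙ (g (suc j) ∙ b)    ≈⟨ assoc _ _ _ ⟨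
        H (suc j) ∙ g (suc j) ∙ b      ≈⟨ ∙-congʳ (H-step (suc j)) ⟩
        H (suc (suc j)) ∙ b            ∎
        where open import Relation.Binary.Reasoning.Setoid setoid

  -- If β_j = α then g_{j+1} ∈ G[β_{j+1} ∩ β_j], so h_{j+2} = h_{j+1} g_{j+1} lies in both
  -- h_{j+1} G[β_{j+1} ∩ β_j] and h_{j+2} G[β_{j+1} ∩ β_{j+2}].
  B⊂α : ∀ j → B j ⊂ α
  B⊂α j with B j ⊂? α
  ... | yes B⊂α = B⊂α
  ... | no B⊄α  = ⊥-elim (cosets-disjoint j
                    (g (suc j) , ∈G-mono (λ e∈ → x∈p∩q⁺ (e∈ , α⊆B (β⊆ _ e∈))) (g∈G (suc j)) ,
                     sym (H-step (suc j)))
                    ∈coset-self)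
    where
      α⊆B : α ⊆ B j
      α⊆B {e} e∈α with e ∈? B j
      ... | yes e∈B = e∈B
      ... | no e∉B  = ⊥-elim (B⊄α (β⊆ _ , e , e∈α , e∉B))

  chain : (m : ℕ) → Chain m
  chain m = record
    { αs   = λ i → B (suc i)
    ; gs   = λ i → g (suc i)
    ; αs⊂E = λ i _ → ⊂-⊆-trans (B⊂α (suc i)) ⊆⊤
    ; gs∈  = λ i _ → g∈G (suc i)
    ; disj = λ i _ (x , x∈ , (y , y∈ , x≈gy)) →
               translated-cosets-disjoint (suc i) (∈G-mono (p∩q⊆q∩p _ _) x∈) y∈ x≈gy
    }

  chain⊂α : ∀ {m} i → i < m → Chain.αs (chain m) i ⊂ α
  chain⊂α i _ = B⊂α (suc i)

  cycleWord : ℕ → ℕ → List (Fin k) → List (Fin k)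
  cycleWord a zero    t = t
  cycleWord a (suc l) t = w a ++ cycleWord (suc a) l t

  cycleWord∈α : ∀ a l {t} → Word∈ α t → Word∈ α (cycleWord a l t)
  cycleWord∈α a zero    t∈ = t∈
  cycleWord∈α a (suc l) t∈ = ++⁺ (All.map (β⊆ _) (w∈B a)) (cycleWord∈α (suc a) l t∈)

  H-cycleWord : ∀ a l t → H a ∙ eval (cycleWord a l t) ≈ H (a + l) ∙ eval t
  H-cycleWord a zero    t = ∙-congʳ (reflexive (≡.cong H (≡.sym (+-identityʳ a))))
  H-cycleWord a (suc l) t = begin
    H a ∙ eval (w a ++ cycleWord (suc a) l t)     ≈⟨ ∙-congˡ (eval-++ (w a) _) ⟩
    H a ∙ (g a ∙ eval (cycleWord (suc a) l t))    ≈⟨ assoc _ _ _ ⟨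
    H a ∙ g a ∙ eval (cycleWord (suc a) l t)      ≈⟨ ∙-congʳ (H-step a) ⟩
    H (suc a) ∙ eval (cycleWord (suc a) l t)      ≈⟨ H-cycleWord (suc a) l t ⟩
    H (suc a + l) ∙ eval t                        ≈⟨ ∙-congʳ (reflexive (≡.cong H (≡.sym (+-suc a l)))) ⟩
    H (a + suc l) ∙ eval t                        ∎
    where open import Relation.Binary.Reasoning.Setoid setoid

  module CycleWalk (m′ : ℕ) where
    open ChainGraph 𝔾 (chain (suc m′))

    Start : Pre (chain (suc m′)) → Set (c ⊔ ℓ)
    Start = InCoset 0 ε (B 1 ∩ B 0)

    EndCoset : ℕ → Carrier → Set (c ⊔ ℓ)
    EndCoset j x = x ∈ g (suc j) G[ B (suc j) ∩ B (suc (suc j)) ]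

    End : Pre (chain (suc m′)) → Set (c ⊔ ℓ)
    End = InCoset m′ (g (suc m′)) (B (suc m′) ∩ B (suc (suc m′)))

    Start-glue : ∀ {a b} → Glue (chain (suc m′)) a b → Start a ⇔ Start b
    Start-glue (Glue.inside x≈y) =
      mk⇔ (λ (i≡0 , x∈) → i≡0 , ∈coset-resp x≈y x∈)
          (λ (i≡0 , y∈) → i≡0 , ∈coset-resp (sym x≈y) y∈)
    Start-glue {a@(_ , _ , x , _)} (Glue.glue y∈ x≈gy) =
      mk⇔ (λ a∈ → ⊥-elim (leave a∈)) λ { (() , _) }
      where
        leave : Start a → ⊥
        leave (≡.refl , u , u∈ , x≈εu) =
          translated-cosets-disjoint 0 u∈ y∈ (trans (sym (identityˡ u)) (trans (sym x≈εu) x≈gy))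

    End-glue : ∀ {a b} → Glue (chain (suc m′)) a b → End a ⇔ End b
    End-glue (Glue.inside x≈y) =
      mk⇔ (λ (i≡m′ , x∈) → i≡m′ , ∈coset-resp x≈y x∈)
          (λ (i≡m′ , y∈) → i≡m′ , ∈coset-resp (sym x≈y) y∈)
    End-glue {a@(i , _ , x , _)} {b@(_ , p′ , y , _)} (Glue.glue y∈ _) =
      mk⇔ (λ a∈ → ⊥-elim (leave a∈)) (λ b∈ → ⊥-elim (enter b∈))
      where
        leave : End a → ⊥
        leave (≡.refl , _) = <-irrefl ≡.refl p′
        enter : End b → ⊥
        enter (1+i≡m′ , y∈End) =
          let (u , u∈ , y≈gu) = ≡.subst (λ j → EndCoset j y) (≡.sym 1+i≡m′) y∈End
          in translated-cosets-disjoint (suc i) (∈G-mono (p∩q⊆q∩p _ _) y∈) u∈ y≈gu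

    Start-closed : ∀ {a b} → Same (chain (suc m′)) a b → Start a → Start b
    Start-closed = Same-invariant Start Start-glue

    End-closed : ∀ {a b} → Same (chain (suc m′)) a b → End a → End b
    End-closed = Same-invariant End End-glue

    Start-End-disjoint : ∀ {x} → Start x → ¬ End x
    Start-End-disjoint {_ , _ , x , _} (≡.refl , a , a∈ , x≈εa) (0≡m′ , x∈End) =
      let (b , b∈ , x≈gb) = ≡.subst (λ j → EndCoset j x) (≡.sym 0≡m′) x∈End
      in translated-cosets-disjoint 0 a∈ b∈ (trans (sym (identityˡ a)) (trans (sym x≈εa) x≈gb))

    start∈ : Start (0 , s≤s z≤n , ε , ε∈G)
    start∈ = ≡.refl , ∈coset-self

    end∈ : End (m′ , ≤-refl , g (suc m′) , g∈G (suc m′))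
    end∈ = ≡.refl , ∈coset-self

    traverse : ∀ l j (p : j < suc m′) t (q : t < suc m′) → t ≡ l + j → ∀ {tail y} →
               Act (chain (suc m′)) tail (t , q , g (suc t) , g∈G (suc t)) y →
               Act (chain (suc m′)) (cycleWord (suc j) (suc l) tail) (j , p , ε , ε∈G) y
    traverse zero j p .j q ≡.refl {tail} t→y =
      Act-within-copy p (w∈B (suc j)) ε∈G (g∈G (suc j)) (sym (identityˡ _))
        (Act-respˡ tail (EqClosure.return (Glue.inside refl)) t→y)
    traverse (suc l) j p t q t≡ {tail} t→y =
      Act-within-copy p (w∈B (suc j)) ε∈G (g∈G (suc j)) (sym (identityˡ _))
        (Act-respˡ (cycleWord (suc (suc j)) (suc l) tail)
          (EqClosure.return (Glue.glue ε∈G (sym (identityʳ _))))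
          (traverse l (suc j) 1+j<m t q (≡.trans t≡ (≡.sym (+-suc l j))) t→y))
      where
        1+j<m : suc j < suc m′
        1+j<m = ≤-trans (s≤s (s≤s (m≤n+m j l))) (≡.subst (λ x → suc x ≤ suc m′) t≡ q)

    chain-incompatible : ∀ {t} → Word∈ (B (suc (suc m′))) t → H (suc (suc m′)) ∙ eval t ≈ H 0 →
                   ¬ Compatible (chain (suc m′)) α
    chain-incompatible {t} t∈ closes compatible
      with Act-stays⁻ (InCoset-stable {I = 0} {h = ε} {γ = B 0} Start-closed) (w∈B 0) start∈
         | Act-stays (InCoset-stable {I = m′} {h = g (suc m′)} {γ = B (suc (suc m′))} End-closed)
                     t∈ end∈
    ... | z , z∈Start , z→start | y , y∈End , end→y =
      Start-End-disjoint {y} (Start-closed (compatible W W∈α W≈ε z y z→y) z∈Start) y∈End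
      where
        W : List (Fin k)
        W = cycleWord 0 (suc (suc m′)) t
        W∈α : Word∈ α W
        W∈α = cycleWord∈α 0 (suc (suc m′)) (All.map (β⊆ _) t∈)
        W≈ε : eval W ≈ ε
        W≈ε = identityʳ-unique (H 0) (eval W) (trans (H-cycleWord 0 (suc (suc m′)) t) closes)
        z→y : Act (chain (suc m′)) W z y
        z→y = Act-++ (w 0) z→start
                (traverse m′ 0 (s≤s z≤n) m′ ≤-refl (≡.sym (+-identityʳ m′)) end→y)

lemma5p1 : ∀ {c ℓ : Level} {k : ℕ} (𝔾 : EGroup k c ℓ) (α : Subset k) (n : ℕ) → 1 ≤ n →
    (∀ (m : ℕ) → 1 ≤ m → m ≤ n → (C : EG.Chain 𝔾 m) →
      (∀ i → i < m → EG.Chain.αs C i ⊂ α) → EG.Compatible 𝔾 C α) →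
    EG.Acyclic 𝔾 (n + 2) α
lemma5p1 _ _ _ _ _ (suc zero) (s≤s ()) _ _
lemma5p1 𝔾 α n 1≤n compatible (suc (suc zero)) _ _ cycle =
  CycleWalk.chain-incompatible 0 [] (trans (identityʳ _) H-periodic)
    (compatible 1 ≤-refl 1≤n (chain 1) chain⊂α)
  where open EG 𝔾
        open CycleChains 𝔾 cycle
lemma5p1 𝔾 α n 1≤n compatible (suc (suc (suc m))) _ m+3≤n+2 cycle =
  CycleWalk.chain-incompatible m (w∈B (suc (suc m))) (trans (H-step (suc (suc m))) H-periodic)
    (compatible (suc m) (s≤s z≤n) m+1≤n (chain (suc m)) chain⊂α)
  where open EG 𝔾
        open CycleChains 𝔾 cycle
        m+1≤n : suc m ≤ n
        m+1≤n = s≤s⁻¹ (s≤s⁻¹ (≡.subst (suc (suc (suc m)) ≤_) (+-comm n 2) m+3≤n+2))
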